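{- For all $n\ge1$ and $0\le k\le n$, $$P_{1,k,2n}=\binom{n-1}{k}\binom{n}{k+1}(n!)^2\quad\text{and}\quad P_{0,k,2n}=\binom{n-1}{k}\binom{n}{k}(n!)^2.$$
   Context: $\mathcal{S}_m$ denotes the set of permutations $\sigma=\sigma_1\cdots\sigma_m$ of $\{1,\dots,m\}$. $\overrightarrow{des}_E(\sigma)$ is the number of indices $i\in\{1,\dots,m-1\}$ with $\sigma_i>\sigma_{i+1}$ and $\sigma_{i+1}$ even. For $j\in\{0,1\}$, $P_{j,k,m}$ is the number of $\sigma\in\mathcal{S}_m$ with $\overrightarrow{des}_E(\sigma)=k$ such that $\sigma_1$ is even if $j=1$ and $\sigma_1$ is odd if $j=0$. Binomial coefficients $\binom{a}{b}$ are $0$ when $b<0$ or $b>a$. -}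

module Defs where

open import Data.Nat using (ℕ; zero; suc; _+_; _<ᵇ_; _≡ᵇ_; _%_)
open import Data.Bool using (Bool; true; false; _∧_; _∨_; not; if_then_else_; T)
open import Data.List using (List; []; _∷_; length; upTo)
open import Data.Product using (Σ; _×_)
open import Data.Fin using (Fin)
open import Function.Bundles using (_↔_)

allB : (ℕ → Bool) → List ℕ → Bool
allB p []       = true
allB p (x ∷ xs) = p x ∧ allB p xs

count : ℕ → List ℕ → ℕ
count x []       = 0
count x (y ∷ ys) = if x ≡ᵇ y then suc (count x ys) else count x ys

isPerm : ℕ → List ℕ → Bool
isPerm m w = (length w ≡ᵇ m) ∧ allB (λ i → count (suc i) w ≡ᵇ 1) (upTo m)

isEven : ℕ → Bool
isEven n = n % 2 ≡ᵇ 0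

desE : List ℕ → ℕ
desE []           = 0
desE (a ∷ [])     = 0
desE (a ∷ b ∷ w)  = (if (b <ᵇ a) ∧ isEven b then 1 else 0) + desE (b ∷ w)

firstOK : Fin 2 → List ℕ → Bool
firstOK j []      = false
firstOK Fin.zero (a ∷ _) = not (isEven a)
firstOK (Fin.suc Fin.zero) (a ∷ _) = isEven a

PSet : Fin 2 → ℕ → ℕ → Set
PSet j k m = Σ (List ℕ) λ σ → T (isPerm m σ) × T ((desE σ ≡ᵇ k) ∧ firstOK j σ)

HasCard : Set → ℕ → Set
HasCard A N = A ↔ Fin N

module Submission where

-- Inserting the letter m + 1 at every position of every permutation of {1,…,m} lists
-- each permutation of {1,…,m+1} exactly once.  In front of τ it creates a descent iff
-- τ₁ is even; between neighbours a and b it creates one iff a < b and b is even, and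
-- otherwise leaves desE unchanged.  Every even letter after τ₁ is the bottom of a
-- descent or the top of such an ascent, so there are ⌊m/2⌋ − desE τ − [τ₁ even] of
-- those ascents.  Summing over τ gives a recurrence for P_{j,k,m} in m, and the closed
-- form C(⌈m/2⌉ − 1, k) · C(⌊m/2⌋, k + j) · ⌊m/2⌋! · ⌈m/2⌉!, whose case m = 2n is the
-- theorem, satisfies it by Pascal's rule and the absorption identity.

open import Defs
open import Data.Bool using (Bool; true; false; _∧_; not; T; if_then_else_)
open import Data.Bool.Properties using (T-irrelevant; T-∧; ∧-zeroʳ; ∧-identityʳ)
open import Data.Fin using (Fin; zero; suc; toℕ)
open import Data.List using (List; []; _∷_; _++_; map; concatMap; length; lookup; filterᵇ; applyDownFrom; upTo)
open import Data.List.Membership.Propositional using (_∈_; _∉_; find; lose)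
open import Data.List.Membership.Propositional.Properties
  using (∈-lookup; ∈-filter⁺; ∈-filter⁻; ∈-map⁺; ∈-map⁻; ∈-concatMap⁺; ∈-concatMap⁻; ∈-applyDownFrom⁻)
import Data.List.Membership.Setoid.Properties as SetoidMembership
open import Data.List.Properties using (map-++; ≡-dec; ∷-injectiveˡ; ∷-injectiveʳ; length-applyDownFrom)
open import Data.List.Relation.Unary.Any using (here; there; tail; index)
open import Data.List.Relation.Unary.Any.Properties using (lookup-index)
open import Data.List.Relation.Unary.Unique.Propositional using (Unique)
import Data.List.Relation.Unary.AllPairs as AllPairs
import Data.List.Relation.Unary.Unique.Propositional.Properties as Uniqueₚ
open import Data.List.Relation.Unary.All using (All)
import Data.List.Relation.Unary.All as All
import Data.List.Relation.Unary.All.Properties as Allₚ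
open import Data.List.Relation.Binary.Disjoint.Propositional using (Disjoint)
open import Data.List.Relation.Binary.Permutation.Propositional using (_↭_; ↭-refl; ↭-prep; ↭-swap; ↭-trans; ↭-sym)
import Data.List.Relation.Binary.Permutation.Propositional.Properties as ↭
open import Data.Nat using (ℕ; zero; suc; _+_; _*_; _∸_; _≤_; _<_; _!; _≡ᵇ_; _<ᵇ_; s≤s; s≤s⁻¹; s<s; ⌊_/2⌋)
open import Data.Nat.Combinatorics using (_C_; nCk+nC[k+1]≡[n+1]C[k+1]; nC1≡n)
open import Data.Nat.ListAction using (sum)
open import Data.Nat.ListAction.Properties using (sum-++; sum-↭)
open import Data.Nat.Properties
  using (_≟_; suc-injective; ≡ᵇ⇒≡; ≡⇒≡ᵇ; <ᵇ⇒<; <⇒<ᵇ; <-irrefl; ≤∧≢⇒<; <⇒≢; <⇒≯; 1+n≢0; n<1+n; m<n⇒m<1+n;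
         +-suc; +-assoc; +-comm; +-identityʳ; +-cancelʳ-≡; *-identityˡ; *-identityʳ; *-zeroʳ;
         *-distribˡ-+; *-distribʳ-+; n≡⌊n+n/2⌋; +-commutativeSemigroup)
open import Data.List.Membership.DecPropositional _≟_ using (_∈?_)
open import Data.Nat.Tactic.RingSolver using (solve; solve-∀)
open import Algebra.Properties.CommutativeSemigroup +-commutativeSemigroup using (x∙yz≈y∙xz)
open import Data.Product using (Σ; ∃; _×_; _,_; proj₁; proj₂)
open import Function using (_∘_)
open import Function.Bundles using (_↔_; _⇔_; mk↔ₛ′; mk⇔; Equivalence)
open import Function.Properties.Inverse using (↔-trans)
open import Relation.Nullary.Decidable using (T?; yes; no)
open import Relation.Nullary.Negation using (contradiction)
open import Axiom.UniquenessOfIdentityProofs using (module Decidable⇒UIP)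
open import Relation.Binary.Definitions using (DecidableEquality)
open import Relation.Binary.PropositionalEquality

-- Sums over lists

-- The same indicator as in the definition of desE, so that the two agree definitionally.
⟦_⟧ : Bool → ℕ
⟦ b ⟧ = if b then 1 else 0

∑ : {A : Set} → List A → (A → ℕ) → ℕ
∑ xs f = sum (map f xs)

syntax ∑ xs (λ x → e) = ∑[ x ∈ xs ] e

module _ {A : Set} where

  ∑-++ : ∀ xs ys (f : A → ℕ) → ∑ (xs ++ ys) f ≡ ∑ xs f + ∑ ys f
  ∑-++ xs ys f = trans (cong sum (map-++ f xs ys)) (sum-++ (map f xs) (map f ys))

  ∑-concatMap : {B : Set} (g : B → List A) (xs : List B) (f : A → ℕ) →
                ∑ (concatMap g xs) f ≡ ∑[ y ∈ xs ] ∑ (g y) f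
  ∑-concatMap g []       f = refl
  ∑-concatMap g (y ∷ xs) f =
    trans (∑-++ (g y) (concatMap g xs) f) (cong (∑ (g y) f +_) (∑-concatMap g xs f))

  ∑-map : (g : A → A) (xs : List A) (f : A → ℕ) → ∑ (map g xs) f ≡ ∑[ x ∈ xs ] f (g x)
  ∑-map g []       f = refl
  ∑-map g (x ∷ xs) f = cong (f (g x) +_) (∑-map g xs f)

  ∑-+ : ∀ xs (f g : A → ℕ) → ∑[ x ∈ xs ] (f x + g x) ≡ ∑ xs f + ∑ xs g
  ∑-+ []       f g = refl
  ∑-+ (x ∷ xs) f g = trans (cong (f x + g x +_) (∑-+ xs f g)) (interchange (f x) (g x) _ _)
    where
    interchange : ∀ a b c d → a + b + (c + d) ≡ a + c + (b + d)
    interchange = solve-∀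

  ∑-*ˡ : ∀ c xs (f : A → ℕ) → ∑[ x ∈ xs ] (c * f x) ≡ c * ∑ xs f
  ∑-*ˡ c []       f = sym (*-zeroʳ c)
  ∑-*ˡ c (x ∷ xs) f = trans (cong (c * f x +_) (∑-*ˡ c xs f)) (sym (*-distribˡ-+ c (f x) (∑ xs f)))

  ∑-zero : ∀ (xs : List A) → ∑[ x ∈ xs ] 0 ≡ 0
  ∑-zero []       = refl
  ∑-zero (x ∷ xs) = ∑-zero xs

  ∑-cong : ∀ {xs} {f g : A → ℕ} → (∀ {x} → x ∈ xs → f x ≡ g x) → ∑ xs f ≡ ∑ xs g
  ∑-cong {[]}     eq = refl
  ∑-cong {x ∷ xs} eq = cong₂ _+_ (eq (here refl)) (∑-cong (eq ∘ there))

  ∑-↭ : ∀ {xs ys} (f : A → ℕ) → xs ↭ ys → ∑ xs f ≡ ∑ ys f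
  ∑-↭ f p = sum-↭ (↭.map⁺ f p)

  ∑-weighted : ∀ {xs} (w : A → ℕ) (q : A → Bool) {a b} →
               (∀ {x} → x ∈ xs → T (q x) → w x + a ≡ b) →
               ∑[ x ∈ xs ] (w x * ⟦ q x ⟧) + a * ∑[ x ∈ xs ] ⟦ q x ⟧ ≡ b * ∑[ x ∈ xs ] ⟦ q x ⟧
  ∑-weighted {xs} w q {a} {b} hyp = begin
    ∑[ x ∈ xs ] (w x * ⟦ q x ⟧) + a * ∑[ x ∈ xs ] ⟦ q x ⟧
      ≡⟨ cong (∑[ x ∈ xs ] (w x * ⟦ q x ⟧) +_) (∑-*ˡ a xs (λ x → ⟦ q x ⟧)) ⟨
    ∑[ x ∈ xs ] (w x * ⟦ q x ⟧) + ∑[ x ∈ xs ] (a * ⟦ q x ⟧)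
      ≡⟨ ∑-+ xs (λ x → w x * ⟦ q x ⟧) (λ x → a * ⟦ q x ⟧) ⟨
    ∑[ x ∈ xs ] (w x * ⟦ q x ⟧ + a * ⟦ q x ⟧)
      ≡⟨ ∑-cong weigh ⟩
    ∑[ x ∈ xs ] (b * ⟦ q x ⟧)
      ≡⟨ ∑-*ˡ b xs (λ x → ⟦ q x ⟧) ⟩
    b * ∑[ x ∈ xs ] ⟦ q x ⟧ ∎
    where
    open ≡-Reasoning
    weigh : ∀ {x} → x ∈ xs → w x * ⟦ q x ⟧ + a * ⟦ q x ⟧ ≡ b * ⟦ q x ⟧
    weigh {x} x∈xs with q x in qx
    ... | true  = trans (sym (*-distribʳ-+ 1 (w x) a)) (cong (_* 1) (hyp x∈xs (subst T (sym qx) _)))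
    ... | false = trans (cong₂ _+_ (*-zeroʳ (w x)) (*-zeroʳ a)) (sym (*-zeroʳ b))

-- Counts as cardinalities

length-filterᵇ : {A : Set} (q : A → Bool) (xs : List A) → length (filterᵇ q xs) ≡ ∑[ x ∈ xs ] ⟦ q x ⟧
length-filterᵇ q []       = refl
length-filterᵇ q (x ∷ xs) with q x
... | true  = cong suc (length-filterᵇ q xs)
... | false = length-filterᵇ q xs

module _ {A : Set} (_≟ᴬ_ : DecidableEquality A) where

  unique⇒∈-irrelevant : ∀ {xs : List A} → Unique xs → ∀ {x} (p q : x ∈ xs) → p ≡ q
  unique⇒∈-irrelevant = SetoidMembership.unique⇒irrelevant (setoid A) (Decidable⇒UIP.≡-irrelevant _≟ᴬ_)

  index-∈-lookup : ∀ (xs : List A) i → index (∈-lookup {xs = xs} i) ≡ i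
  index-∈-lookup (x ∷ xs) zero    = refl
  index-∈-lookup (x ∷ xs) (suc i) = cong suc (index-∈-lookup xs i)

  ∃∈↔Fin : ∀ {xs} → Unique xs → (∃ λ x → x ∈ xs) ↔ Fin (length xs)
  ∃∈↔Fin {xs} uniq = mk↔ₛ′ (index ∘ proj₂) (λ i → lookup xs i , ∈-lookup i) (index-∈-lookup xs) from∘to
    where
    from∘to : ∀ (p : ∃ λ x → x ∈ xs) → (lookup xs (index (proj₂ p)) , ∈-lookup (index (proj₂ p))) ≡ p
    from∘to (x , x∈xs) = at (lookup-index x∈xs) (∈-lookup (index x∈xs))
      where
      at : ∀ {y} → x ≡ y → (y∈xs : y ∈ xs) → (y , y∈xs) ≡ (x , x∈xs)
      at refl y∈xs = cong (x ,_) (unique⇒∈-irrelevant uniq y∈xs x∈xs)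

  Σ-T-↔-Fin : (p q : A → Bool) {xs : List A} → Unique xs → (∀ {x} → T (p x) ⇔ x ∈ xs) →
              Σ A (λ x → T (p x) × T (q x)) ↔ Fin (∑[ x ∈ xs ] ⟦ q x ⟧)
  Σ-T-↔-Fin p q {xs} uniq p⇔∈ =
    subst (λ n → Σ A (λ x → T (p x) × T (q x)) ↔ Fin n) (length-filterᵇ q xs)
      (↔-trans to-filter (∃∈↔Fin (Uniqueₚ.filter⁺ (T? ∘ q) uniq)))
    where
    to-filter : Σ A (λ x → T (p x) × T (q x)) ↔ (∃ λ x → x ∈ filterᵇ q xs)
    to-filter = mk↔ₛ′
      (λ (x , px , qx) → x , ∈-filter⁺ (T? ∘ q) (Equivalence.to p⇔∈ px) qx)
      (λ (x , x∈) → let x∈xs , qx = ∈-filter⁻ (T? ∘ q) {xs = xs} x∈ in x , Equivalence.from p⇔∈ x∈xs , qx)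
      (λ (x , x∈) → cong (x ,_) (unique⇒∈-irrelevant (Uniqueₚ.filter⁺ (T? ∘ q) {xs} uniq) _ _))
      (λ (x , px , qx) → cong (x ,_) (cong₂ _,_ (T-irrelevant _ _) (T-irrelevant _ _)))

-- Permutations by insertion of a new largest letter

insertions : {A : Set} → A → List A → List (List A)
insertions v []       = (v ∷ []) ∷ []
insertions v (x ∷ xs) = (v ∷ x ∷ xs) ∷ map (x ∷_) (insertions v xs)

module _ {A : Set} where

  ∷∈insertions : ∀ (v : A) xs → v ∷ xs ∈ insertions v xs
  ∷∈insertions v []       = here refl
  ∷∈insertions v (x ∷ xs) = here refl

  insertions-↭ : ∀ {v : A} {xs σ} → σ ∈ insertions v xs → σ ↭ v ∷ xs
  insertions-↭ {xs = []}     (here refl) = ↭-refl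
  insertions-↭ {xs = x ∷ xs} (here refl) = ↭-refl
  insertions-↭ {v} {x ∷ xs}  (there σ∈)
    with w , w∈ , refl ← ∈-map⁻ (x ∷_) σ∈ = ↭-trans (↭-prep x (insertions-↭ w∈)) (↭-swap x v ↭-refl)

  insertions-unique : ∀ {v : A} {xs} → v ∉ xs → Unique (insertions v xs)
  insertions-unique {xs = []}     v∉ = All.[] AllPairs.∷ AllPairs.[]
  insertions-unique {xs = x ∷ xs} v∉ =
    Allₚ.map⁺ (All.universal (λ w eq → v∉ (here (∷-injectiveˡ eq))) _)
      AllPairs.∷ Uniqueₚ.map⁺ ∷-injectiveʳ (insertions-unique (v∉ ∘ there))

module _ {A : Set} (_≟ᴬ_ : DecidableEquality A) where

  remove : A → List A → List A
  remove v []       = []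
  remove v (x ∷ xs) with v ≟ᴬ x
  ... | yes _ = xs
  ... | no  _ = x ∷ remove v xs

  remove-∷ : ∀ v xs → remove v (v ∷ xs) ≡ xs
  remove-∷ v xs with v ≟ᴬ v
  ... | yes _   = refl
  ... | no  v≢v = contradiction refl v≢v

  remove-∷-≢ : ∀ {v x} xs → v ≢ x → remove v (x ∷ xs) ≡ x ∷ remove v xs
  remove-∷-≢ {v} {x} xs v≢x with v ≟ᴬ x
  ... | yes v≡x = contradiction v≡x v≢x
  ... | no  _   = refl

  remove-insertions : ∀ {v xs σ} → v ∉ xs → σ ∈ insertions v xs → remove v σ ≡ xs
  remove-insertions {v} {[]}     v∉ (here refl) = remove-∷ v []
  remove-insertions {v} {x ∷ xs} v∉ (here refl) = remove-∷ v (x ∷ xs)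
  remove-insertions {v} {x ∷ xs} v∉ (there σ∈)
    with w , w∈ , refl ← ∈-map⁻ (x ∷_) σ∈ =
    trans (remove-∷-≢ w (v∉ ∘ here)) (cong (x ∷_) (remove-insertions (v∉ ∘ there) w∈))

  insertions-remove : ∀ {v σ} → v ∈ σ → σ ∈ insertions v (remove v σ)
  insertions-remove {v} {x ∷ σ} v∈ with v ≟ᴬ x
  ... | yes refl = ∷∈insertions v σ
  ... | no  v≢x  = there (∈-map⁺ (x ∷_) (insertions-remove (tail v≢x v∈)))

  concatMap-insertions-unique : ∀ {v L} → All (v ∉_) L → Unique L → Unique (concatMap (insertions v) L)
  concatMap-insertions-unique All.[] AllPairs.[] = AllPairs.[]
  concatMap-insertions-unique {v} {τ ∷ L} (v∉τ All.∷ v∉L) (τ∉L AllPairs.∷ uniq) =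
    Uniqueₚ.++⁺ (insertions-unique v∉τ) (concatMap-insertions-unique v∉L uniq) disjoint
    where
    disjoint : Disjoint (insertions v τ) (concatMap (insertions v) L)
    disjoint (σ∈τ , σ∈L) with τ′ , τ′∈L , σ∈τ′ ← find (∈-concatMap⁻ (insertions v) {xs = L} σ∈L) =
      All.lookup τ∉L τ′∈L
        (trans (sym (remove-insertions v∉τ σ∈τ)) (remove-insertions (All.lookup v∉L τ′∈L) σ∈τ′))

perms : ℕ → List (List ℕ)
perms zero    = [] ∷ []
perms (suc m) = concatMap (insertions (suc m)) (perms m)

IsPerm : ℕ → List ℕ → Set
IsPerm m σ = length σ ≡ m × (∀ {i} → i < m → count (suc i) σ ≡ 1)

count≡∑ : ∀ x xs → count x xs ≡ ∑[ y ∈ xs ] ⟦ x ≡ᵇ y ⟧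
count≡∑ x []       = refl
count≡∑ x (y ∷ xs) with x ≡ᵇ y
... | true  = cong suc (count≡∑ x xs)
... | false = count≡∑ x xs

count-↭ : ∀ {x xs ys} → xs ↭ ys → count x xs ≡ count x ys
count-↭ {x} {xs} {ys} p = trans (count≡∑ x xs) (trans (∑-↭ (λ y → ⟦ x ≡ᵇ y ⟧) p) (sym (count≡∑ x ys)))

count-∷ : ∀ x xs → count x (x ∷ xs) ≡ suc (count x xs)
count-∷ x xs with x ≡ᵇ x in eq
... | true  = refl
... | false = contradiction (subst T eq (≡⇒≡ᵇ x x refl)) λ ()

count-∷-≢ : ∀ {x y} xs → x ≢ y → count x (y ∷ xs) ≡ count x xs
count-∷-≢ {x} {y} xs x≢y with x ≡ᵇ y in eq
... | true  = contradiction (≡ᵇ⇒≡ x y (subst T (sym eq) _)) x≢y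
... | false = refl

count-∉ : ∀ {x xs} → x ∉ xs → count x xs ≡ 0
count-∉ {xs = []}     x∉ = refl
count-∉ {xs = y ∷ xs} x∉ = trans (count-∷-≢ xs (x∉ ∘ here)) (count-∉ (x∉ ∘ there))

∈-count : ∀ {x xs} → count x xs ≢ 0 → x ∈ xs
∈-count {x} {xs} c≢0 with x ∈? xs
... | yes x∈ = x∈
... | no  x∉ = contradiction (count-∉ x∉) c≢0

∉-applyDownFrom : ∀ m → suc m ∉ applyDownFrom suc m
∉-applyDownFrom m m+1∈ with i , i<m , eq ← ∈-applyDownFrom⁻ suc m+1∈ = <-irrefl (sym (suc-injective eq)) i<m

count-applyDownFrom : ∀ {i m} → i < m → count (suc i) (applyDownFrom suc m) ≡ 1
count-applyDownFrom {i} {suc m} i<1+m with i ≟ m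
... | yes refl = trans (count-∷ (suc m) (applyDownFrom suc m)) (cong suc (count-∉ (∉-applyDownFrom m)))
... | no  i≢m  = trans (count-∷-≢ (applyDownFrom suc m) (i≢m ∘ suc-injective))
                       (count-applyDownFrom {m = m} (≤∧≢⇒< (s≤s⁻¹ i<1+m) i≢m))

perms-↭ : ∀ {m σ} → σ ∈ perms m → σ ↭ applyDownFrom suc m
perms-↭ {zero}  (here refl) = ↭-refl
perms-↭ {suc m} σ∈ with τ , τ∈ , σ∈τ ← find (∈-concatMap⁻ (insertions (suc m)) {xs = perms m} σ∈) =
  ↭-trans (insertions-↭ σ∈τ) (↭-prep (suc m) (perms-↭ {m} τ∈))

perms-fresh : ∀ {m τ} → τ ∈ perms m → suc m ∉ τ
perms-fresh {m} τ∈ = ∉-applyDownFrom m ∘ ↭.∈-resp-↭ (perms-↭ {m} τ∈)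

perms-< : ∀ {m τ} → τ ∈ perms m → All (_< suc m) τ
perms-< {m} τ∈ = ↭.All-resp-↭ (↭-sym (perms-↭ {m} τ∈)) (All.tabulate bounded)
  where
  bounded : ∀ {x} → x ∈ applyDownFrom suc m → x < suc m
  bounded x∈ with i , i<m , refl ← ∈-applyDownFrom⁻ suc x∈ = s≤s i<m

perms-unique : ∀ m → Unique (perms m)
perms-unique zero    = All.[] AllPairs.∷ AllPairs.[]
perms-unique (suc m) = concatMap-insertions-unique _≟_ (All.tabulate (perms-fresh {m})) (perms-unique m)

perms-sound : ∀ {m σ} → σ ∈ perms m → IsPerm m σ
perms-sound {m} σ∈ = trans (↭.↭-length σ↭) (length-applyDownFrom suc m) ,
                     λ i<m → trans (count-↭ σ↭) (count-applyDownFrom {m = m} i<m)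
  where σ↭ = perms-↭ {m} σ∈

perms-complete : ∀ m {σ} → IsPerm m σ → σ ∈ perms m
perms-complete zero    {[]}    _            = here refl
perms-complete (suc m) {σ} (len , counts) =
  ∈-concatMap⁺ (insertions (suc m)) (lose τ∈ σ∈τ)
  where
  τ = remove _≟_ (suc m) σ
  σ∈τ : σ ∈ insertions (suc m) τ
  σ∈τ = insertions-remove _≟_ (∈-count (λ c≡0 → 1+n≢0 (trans (sym (counts (n<1+n m))) c≡0)))
  σ↭ : σ ↭ suc m ∷ τ
  σ↭ = insertions-↭ σ∈τ
  τ∈ : τ ∈ perms m
  τ∈ = perms-complete m (suc-injective (trans (sym (↭.↭-length σ↭)) len) ,
         λ {i} i<m → trans (sym (count-∷-≢ τ (<⇒≢ (s<s i<m))))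
                       (trans (sym (count-↭ σ↭)) (counts (m<n⇒m<1+n i<m))))

T-allB : ∀ (p : ℕ → Bool) xs → T (allB p xs) ⇔ All (T ∘ p) xs
T-allB p []       = mk⇔ (λ _ → All.[]) (λ _ → _)
T-allB p (x ∷ xs) = mk⇔
  (λ t → let tx , txs = Equivalence.to T-∧ t in tx All.∷ Equivalence.to (T-allB p xs) txs)
  (λ { (tx All.∷ txs) → Equivalence.from T-∧ (tx , Equivalence.from (T-allB p xs) txs) })

isPerm⇔IsPerm : ∀ m σ → T (isPerm m σ) ⇔ IsPerm m σ
isPerm⇔IsPerm m σ = mk⇔
  (λ t → let tl , tc = Equivalence.to T-∧ t in
    ≡ᵇ⇒≡ _ _ tl , λ {i} i<m → ≡ᵇ⇒≡ _ _ (Allₚ.applyUpTo⁻ _ m (Equivalence.to (T-allB _ (upTo m)) tc) i<m))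
  (λ (len , counts) → Equivalence.from T-∧
    (≡⇒≡ᵇ _ _ len ,
     Equivalence.from (T-allB _ (upTo m)) (Allₚ.applyUpTo⁺₁ _ m (λ i<m → ≡⇒≡ᵇ _ _ (counts i<m)))))

isPerm⇔∈perms : ∀ m {σ} → T (isPerm m σ) ⇔ σ ∈ perms m
isPerm⇔∈perms m {σ} = mk⇔ (perms-complete m ∘ Equivalence.to (isPerm⇔IsPerm m σ))
                          (Equivalence.from (isPerm⇔IsPerm m σ) ∘ perms-sound {m})

counted : ℕ → Fin 2 → List ℕ → Bool
counted k j σ = (desE σ ≡ᵇ k) ∧ firstOK j σ

P : ℕ → ℕ → Fin 2 → ℕ
P m k j = ∑[ σ ∈ perms m ] ⟦ counted k j σ ⟧

PSet↔P : ∀ j k m → HasCard (PSet j k m) (P m k j)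
PSet↔P j k m = Σ-T-↔-Fin (≡-dec _≟_) (isPerm m) (counted k j) (perms-unique m) (isPerm⇔∈perms m)

-- Descents after inserting a new largest letter

ascE : List ℕ → ℕ
ascE []          = 0
ascE (a ∷ [])    = 0
ascE (a ∷ b ∷ w) = ⟦ not (b <ᵇ a) ∧ isEven b ⟧ + ascE (b ∷ w)

evens : List ℕ → ℕ
evens σ = ∑[ x ∈ σ ] ⟦ isEven x ⟧

ascE+desE≡evens : ∀ x ρ → ascE (x ∷ ρ) + desE (x ∷ ρ) ≡ evens ρ
ascE+desE≡evens x []      = refl
ascE+desE≡evens x (y ∷ ρ) with y <ᵇ x | isEven y
... | true  | true  = trans (+-suc (ascE (y ∷ ρ)) (desE (y ∷ ρ))) (cong suc (ascE+desE≡evens y ρ))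
... | false | true  = cong suc (ascE+desE≡evens y ρ)
... | true  | false = ascE+desE≡evens y ρ
... | false | false = ascE+desE≡evens y ρ

⌊1+n/2⌋≡⟦even⟧+⌊n/2⌋ : ∀ n → ⌊ suc n /2⌋ ≡ ⟦ isEven (suc n) ⟧ + ⌊ n /2⌋
⌊1+n/2⌋≡⟦even⟧+⌊n/2⌋ zero          = refl
⌊1+n/2⌋≡⟦even⟧+⌊n/2⌋ (suc zero)    = refl
⌊1+n/2⌋≡⟦even⟧+⌊n/2⌋ (suc (suc n)) =
  trans (cong suc (⌊1+n/2⌋≡⟦even⟧+⌊n/2⌋ n)) (sym (+-suc ⟦ isEven (suc n) ⟧ ⌊ n /2⌋))

evens-applyDownFrom : ∀ m → evens (applyDownFrom suc m) ≡ ⌊ m /2⌋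
evens-applyDownFrom zero    = refl
evens-applyDownFrom (suc m) =
  trans (cong (⟦ isEven (suc m) ⟧ +_) (evens-applyDownFrom m)) (sym (⌊1+n/2⌋≡⟦even⟧+⌊n/2⌋ m))

firstOK-∷ : ∀ j x w w′ → firstOK j (x ∷ w) ≡ firstOK j (x ∷ w′)
firstOK-∷ zero       x w w′ = refl
firstOK-∷ (suc zero) x w w′ = refl

firstOK⇒parity : ∀ j x ρ → T (firstOK j (x ∷ ρ)) → ⟦ isEven x ⟧ ≡ toℕ j
firstOK⇒parity zero       x ρ t with isEven x
... | false = refl
firstOK⇒parity (suc zero) x ρ t with isEven x
... | true = refl

perms-ascE : ∀ {m} j τ → τ ∈ perms (suc m) → T (firstOK j τ) → ascE τ + (toℕ j + desE τ) ≡ ⌊ suc m /2⌋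
perms-ascE {m} j (x ∷ ρ) τ∈ first = begin
  ascE (x ∷ ρ) + (toℕ j + desE (x ∷ ρ))
    ≡⟨ cong (λ t → ascE (x ∷ ρ) + (t + desE (x ∷ ρ))) (firstOK⇒parity j x ρ first) ⟨
  ascE (x ∷ ρ) + (⟦ isEven x ⟧ + desE (x ∷ ρ))
    ≡⟨ x∙yz≈y∙xz (ascE (x ∷ ρ)) ⟦ isEven x ⟧ (desE (x ∷ ρ)) ⟩
  ⟦ isEven x ⟧ + (ascE (x ∷ ρ) + desE (x ∷ ρ))
    ≡⟨ cong (⟦ isEven x ⟧ +_) (ascE+desE≡evens x ρ) ⟩
  evens (x ∷ ρ)
    ≡⟨ ∑-↭ (λ y → ⟦ isEven y ⟧) (perms-↭ {suc m} τ∈) ⟩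
  evens (applyDownFrom suc (suc m))
    ≡⟨ evens-applyDownFrom (suc m) ⟩
  ⌊ suc m /2⌋ ∎
  where open ≡-Reasoning

<ᵇ-false : ∀ {x y} → x < y → (y <ᵇ x) ≡ false
<ᵇ-false {x} {y} x<y with y <ᵇ x in eq
... | true  = contradiction (<ᵇ⇒< y x (subst T (sym eq) _)) (<⇒≯ x<y)
... | false = refl

<ᵇ-true : ∀ {x y} → x < y → (x <ᵇ y) ≡ true
<ᵇ-true {x} {y} x<y with x <ᵇ y in eq
... | true  = refl
... | false = contradiction (subst T eq (<⇒<ᵇ x<y)) λ ()

slot-same : ∀ x y S A ℓ → S + A * x ≡ A * y + suc ℓ * x → x + S + A * x ≡ A * y + suc (suc ℓ) * x
slot-same x y S A ℓ ih = begin
  x + S + A * x            ≡⟨ +-assoc x S (A * x) ⟩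
  x + (S + A * x)          ≡⟨ cong (x +_) ih ⟩
  x + (A * y + suc ℓ * x)  ≡⟨ solve (x ∷ y ∷ A ∷ ℓ ∷ []) ⟩
  A * y + suc (suc ℓ) * x  ∎
  where open ≡-Reasoning

slot-rise : ∀ x y S A ℓ → S + A * x ≡ A * y + suc ℓ * x → y + S + suc A * x ≡ suc A * y + suc (suc ℓ) * x
slot-rise x y S A ℓ ih = begin
  y + S + suc A * x            ≡⟨ solve (x ∷ y ∷ S ∷ A ∷ []) ⟩
  y + x + (S + A * x)          ≡⟨ cong (y + x +_) ih ⟩
  y + x + (A * y + suc ℓ * x)  ≡⟨ solve (x ∷ y ∷ A ∷ ℓ ∷ []) ⟩
  suc A * y + suc (suc ℓ) * x  ∎
  where open ≡-Reasoning

-- Inserting v between neighbours a and b, where lt = [b < a] and e = [b even], changes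
-- desE by ⟦ e ⟧ − ⟦ lt ∧ e ⟧; the hypothesis accounts for the slots further right.
slot-step : ∀ (lt e : Bool) (h : ℕ → Bool) S A D ℓ →
  S + A * ⟦ h (⟦ lt ∧ e ⟧ + D) ⟧
    ≡ A * ⟦ h (⟦ lt ∧ e ⟧ + suc D) ⟧ + suc ℓ * ⟦ h (⟦ lt ∧ e ⟧ + D) ⟧ →
  ⟦ h (⟦ e ⟧ + D) ⟧ + S + (⟦ not lt ∧ e ⟧ + A) * ⟦ h (⟦ lt ∧ e ⟧ + D) ⟧
    ≡ (⟦ not lt ∧ e ⟧ + A) * ⟦ h (suc (⟦ lt ∧ e ⟧ + D)) ⟧ + suc (suc ℓ) * ⟦ h (⟦ lt ∧ e ⟧ + D) ⟧
slot-step true  true  h S A D ℓ ih = slot-same ⟦ h (suc D) ⟧ ⟦ h (suc (suc D)) ⟧ S A ℓ ih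
slot-step false true  h S A D ℓ ih = slot-rise ⟦ h D ⟧ ⟦ h (suc D) ⟧ S A ℓ ih
slot-step true  false h S A D ℓ ih = slot-same ⟦ h D ⟧ ⟦ h (suc D) ⟧ S A ℓ ih
slot-step false false h S A D ℓ ih = slot-same ⟦ h D ⟧ ⟦ h (suc D) ⟧ S A ℓ ih

∑-slots : ∀ {v} x ρ (h : ℕ → Bool) → All (_< v) (x ∷ ρ) →
  ∑[ w ∈ insertions v ρ ] ⟦ h (desE (x ∷ w)) ⟧ + ascE (x ∷ ρ) * ⟦ h (desE (x ∷ ρ)) ⟧
    ≡ ascE (x ∷ ρ) * ⟦ h (suc (desE (x ∷ ρ))) ⟧ + suc (length ρ) * ⟦ h (desE (x ∷ ρ)) ⟧
∑-slots {v} x [] h (x<v All.∷ All.[]) =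
  trans (+-identityʳ _) (cong (λ b → ⟦ h (⟦ b ∧ isEven v ⟧ + 0) ⟧ + 0) (<ᵇ-false x<v))
∑-slots {v} x (y ∷ ρ) h (x<v All.∷ y<v All.∷ bound) =
  trans (cong₂ (λ d S → ⟦ h d ⟧ + S + ascE (x ∷ y ∷ ρ) * ⟦ h (desE (x ∷ y ∷ ρ)) ⟧)
               inserted-first (∑-map (y ∷_) (insertions v ρ) (λ w → ⟦ h (desE (x ∷ w)) ⟧)))
        (slot-step (y <ᵇ x) (isEven y) h _ (ascE (y ∷ ρ)) (desE (y ∷ ρ)) (length ρ)
           (∑-slots y ρ (λ d → h (⟦ (y <ᵇ x) ∧ isEven y ⟧ + d)) (y<v All.∷ bound)))
  where
  inserted-first : desE (x ∷ v ∷ y ∷ ρ) ≡ ⟦ isEven y ⟧ + desE (y ∷ ρ)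
  inserted-first rewrite <ᵇ-false x<v | <ᵇ-true y<v = refl

counted′ : ℕ → Fin 2 → List ℕ → Bool
counted′ k j σ = (suc (desE σ) ≡ᵇ k) ∧ firstOK j σ

⟦∧⟧ : ∀ a b → ⟦ a ∧ b ⟧ ≡ ⟦ b ⟧ * ⟦ a ⟧
⟦∧⟧ true  true  = refl
⟦∧⟧ true  false = refl
⟦∧⟧ false true  = refl
⟦∧⟧ false false = refl

⟦+≡ᵇ⟧-split : ∀ e f D k →
  ⟦ ((⟦ e ⟧ + D) ≡ᵇ k) ∧ f ⟧ ≡ ⟦ f ⟧ * (⟦ (D ≡ᵇ k) ∧ not e ⟧ + ⟦ (suc D ≡ᵇ k) ∧ e ⟧)
⟦+≡ᵇ⟧-split true  f D k = trans (⟦∧⟧ (suc D ≡ᵇ k) f)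
  (cong (⟦ f ⟧ *_) (cong₂ _+_ (cong ⟦_⟧ (sym (∧-zeroʳ (D ≡ᵇ k))))
                             (cong ⟦_⟧ (sym (∧-identityʳ (suc D ≡ᵇ k))))))
⟦+≡ᵇ⟧-split false f D k = trans (⟦∧⟧ (D ≡ᵇ k) f)
  (cong (⟦ f ⟧ *_) (trans (sym (+-identityʳ ⟦ D ≡ᵇ k ⟧))
    (cong₂ _+_ (cong ⟦_⟧ (sym (∧-identityʳ (D ≡ᵇ k)))) (cong ⟦_⟧ (sym (∧-zeroʳ (suc D ≡ᵇ k)))))))

counted-∷-max : ∀ {v x} k j ρ → x < v →
  ⟦ counted k j (v ∷ x ∷ ρ) ⟧
    ≡ ⟦ firstOK j (v ∷ []) ⟧ * (⟦ counted k zero (x ∷ ρ) ⟧ + ⟦ counted′ k (suc zero) (x ∷ ρ) ⟧)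
counted-∷-max {v} {x} k j ρ x<v =
  trans (cong₂ (λ b f → ⟦ ((⟦ b ∧ isEven x ⟧ + desE (x ∷ ρ)) ≡ᵇ k) ∧ f ⟧)
               (<ᵇ-true x<v) (firstOK-∷ j v (x ∷ ρ) []))
        (⟦+≡ᵇ⟧-split (isEven x) (firstOK j (v ∷ [])) (desE (x ∷ ρ)) k)

insertions-counted : ∀ {v} k j τ → All (_< v) τ →
  ∑[ σ ∈ insertions v τ ] ⟦ counted k j σ ⟧ + ascE τ * ⟦ counted k j τ ⟧
    ≡ ⟦ counted k j (v ∷ τ) ⟧ + ascE τ * ⟦ counted′ k j τ ⟧ + length τ * ⟦ counted k j τ ⟧
insertions-counted k j []      _     = refl
insertions-counted {v} k j (x ∷ ρ) bound = begin
  ⟦ counted k j (v ∷ x ∷ ρ) ⟧ + ∑[ σ ∈ map (x ∷_) (insertions v ρ) ] ⟦ counted k j σ ⟧ + A * X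
    ≡⟨ cong (λ S → ⟦ counted k j (v ∷ x ∷ ρ) ⟧ + S + A * X) slots ⟩
  ⟦ counted k j (v ∷ x ∷ ρ) ⟧ + ∑[ w ∈ insertions v ρ ] ⟦ h (desE (x ∷ w)) ⟧ + A * X
    ≡⟨ +-assoc ⟦ counted k j (v ∷ x ∷ ρ) ⟧ _ (A * X) ⟩
  ⟦ counted k j (v ∷ x ∷ ρ) ⟧ + (∑[ w ∈ insertions v ρ ] ⟦ h (desE (x ∷ w)) ⟧ + A * X)
    ≡⟨ cong (⟦ counted k j (v ∷ x ∷ ρ) ⟧ +_) (∑-slots x ρ h bound) ⟩
  ⟦ counted k j (v ∷ x ∷ ρ) ⟧ + (A * ⟦ counted′ k j (x ∷ ρ) ⟧ + suc (length ρ) * X)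
    ≡⟨ +-assoc ⟦ counted k j (v ∷ x ∷ ρ) ⟧ (A * ⟦ counted′ k j (x ∷ ρ) ⟧) _ ⟨
  ⟦ counted k j (v ∷ x ∷ ρ) ⟧ + A * ⟦ counted′ k j (x ∷ ρ) ⟧ + suc (length ρ) * X ∎
  where
  open ≡-Reasoning
  A = ascE (x ∷ ρ)
  X = ⟦ counted k j (x ∷ ρ) ⟧
  h : ℕ → Bool
  h d = (d ≡ᵇ k) ∧ firstOK j (x ∷ ρ)
  slots : ∑[ σ ∈ map (x ∷_) (insertions v ρ) ] ⟦ counted k j σ ⟧
            ≡ ∑[ w ∈ insertions v ρ ] ⟦ h (desE (x ∷ w)) ⟧
  slots = trans (∑-map (x ∷_) (insertions v ρ) (λ σ → ⟦ counted k j σ ⟧))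
                (∑-cong {xs = insertions v ρ} λ {w} _ →
                   cong (λ f → ⟦ (desE (x ∷ w) ≡ᵇ k) ∧ f ⟧) (firstOK-∷ j x w ρ))

-- The recurrence in m

prev : (ℕ → ℕ) → ℕ → ℕ
prev f zero    = 0
prev f (suc k) = f k

∑-counted′ : ∀ L k j →
  ∑[ σ ∈ L ] ⟦ counted′ k j σ ⟧ ≡ prev (λ i → ∑[ σ ∈ L ] ⟦ counted i j σ ⟧) k
∑-counted′ L zero    j = ∑-zero L
∑-counted′ L (suc k) j = refl

-- With h = ⌊m/2⌋ and v = m + 1, this is
--   P (m+1) k j = [v has parity j]·(P m k 0 + P m (k−1) 1)
--                 + (h + 1 − k − j)·P m (k−1) j + (m − h + k + j)·P m k j,
-- with the subtracted terms moved to the left-hand side.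
record RecurrenceAt (m h : ℕ) (next cur : ℕ → Fin 2 → ℕ) : Set where
  field
    holds : ∀ k j →
      next k j + h * cur k j + (toℕ j + k) * prev (λ i → cur i j) k
        ≡ ⟦ firstOK j (suc m ∷ []) ⟧ * (cur k zero + prev (λ i → cur i (suc zero)) k)
          + suc h * prev (λ i → cur i j) k + (m + (toℕ j + k)) * cur k j

open RecurrenceAt

recurrence-arith : ∀ x S S′ F M c c′ h e →
  x + S ≡ F + S′ + M * c → S + e * c ≡ h * c → S′ + e * c′ ≡ suc h * c′ →
  x + h * c + e * c′ ≡ F + suc h * c′ + (M + e) * c
recurrence-arith x S S′ F M c c′ h e inserted weighted weighted′ = begin
  x + h * c + e * c′            ≡⟨ cong (λ t → x + t + e * c′) weighted ⟨
  x + (S + e * c) + e * c′      ≡⟨ solve (x ∷ S ∷ e ∷ c ∷ c′ ∷ []) ⟩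
  x + S + e * c + e * c′        ≡⟨ cong (λ t → t + e * c + e * c′) inserted ⟩
  F + S′ + M * c + e * c + e * c′  ≡⟨ solve (F ∷ S′ ∷ M ∷ c ∷ c′ ∷ e ∷ []) ⟩
  F + (S′ + e * c′) + (M + e) * c  ≡⟨ cong (λ t → F + t + (M + e) * c) weighted′ ⟩
  F + suc h * c′ + (M + e) * c  ∎
  where open ≡-Reasoning

perms-insertions-counted : ∀ {m τ} k j → τ ∈ perms (suc m) →
  ∑[ σ ∈ insertions (suc (suc m)) τ ] ⟦ counted k j σ ⟧ + ascE τ * ⟦ counted k j τ ⟧
    ≡ ⟦ firstOK j (suc (suc m) ∷ []) ⟧ * (⟦ counted k zero τ ⟧ + ⟦ counted′ k (suc zero) τ ⟧)
      + ascE τ * ⟦ counted′ k j τ ⟧ + suc m * ⟦ counted k j τ ⟧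
perms-insertions-counted {m} {[]}    k j τ∈ with () ← proj₁ (perms-sound {suc m} τ∈)
perms-insertions-counted {m} {x ∷ ρ} k j τ∈ with x<v All.∷ _ ← perms-< {suc m} τ∈ =
  trans (insertions-counted k j (x ∷ ρ) (perms-< {suc m} τ∈))
        (cong₂ (λ a ℓ → a + ascE (x ∷ ρ) * ⟦ counted′ k j (x ∷ ρ) ⟧ + ℓ * ⟦ counted k j (x ∷ ρ) ⟧)
               (counted-∷-max k j ρ x<v) (proj₁ (perms-sound {suc m} τ∈)))

P-insertion : ∀ m k j →
  P (suc (suc m)) k j + ∑[ τ ∈ perms (suc m) ] (ascE τ * ⟦ counted k j τ ⟧)
    ≡ ⟦ firstOK j (suc (suc m) ∷ []) ⟧ * (P (suc m) k zero + prev (λ i → P (suc m) i (suc zero)) k)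
      + ∑[ τ ∈ perms (suc m) ] (ascE τ * ⟦ counted′ k j τ ⟧) + suc m * P (suc m) k j
P-insertion m k j = begin
  P v k j + ∑[ τ ∈ L ] (A τ * ⟦ q τ ⟧)
    ≡⟨ cong (_+ ∑[ τ ∈ L ] (A τ * ⟦ q τ ⟧)) (∑-concatMap (insertions v) L (⟦_⟧ ∘ q)) ⟩
  ∑[ τ ∈ L ] ∑[ σ ∈ insertions v τ ] ⟦ q σ ⟧ + ∑[ τ ∈ L ] (A τ * ⟦ q τ ⟧)
    ≡⟨ ∑-+ L (λ τ → ∑[ σ ∈ insertions v τ ] ⟦ q σ ⟧) (λ τ → A τ * ⟦ q τ ⟧) ⟨
  ∑[ τ ∈ L ] (∑[ σ ∈ insertions v τ ] ⟦ q σ ⟧ + A τ * ⟦ q τ ⟧)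
    ≡⟨ ∑-cong (perms-insertions-counted {m} k j) ⟩
  ∑[ τ ∈ L ] (fo * front τ + A τ * ⟦ q′ τ ⟧ + suc m * ⟦ q τ ⟧)
    ≡⟨ ∑-+ L (λ τ → fo * front τ + A τ * ⟦ q′ τ ⟧) (λ τ → suc m * ⟦ q τ ⟧) ⟩
  ∑[ τ ∈ L ] (fo * front τ + A τ * ⟦ q′ τ ⟧) + ∑[ τ ∈ L ] (suc m * ⟦ q τ ⟧)
    ≡⟨ cong₂ _+_ (∑-+ L (λ τ → fo * front τ) (λ τ → A τ * ⟦ q′ τ ⟧)) (∑-*ˡ (suc m) L (⟦_⟧ ∘ q)) ⟩
  ∑[ τ ∈ L ] (fo * front τ) + ∑[ τ ∈ L ] (A τ * ⟦ q′ τ ⟧) + suc m * P (suc m) k j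
    ≡⟨ cong (λ t → t + ∑[ τ ∈ L ] (A τ * ⟦ q′ τ ⟧) + suc m * P (suc m) k j) ∑-front ⟩
  fo * (P (suc m) k zero + prev (λ i → P (suc m) i (suc zero)) k)
    + ∑[ τ ∈ L ] (A τ * ⟦ q′ τ ⟧) + suc m * P (suc m) k j ∎
  where
  open ≡-Reasoning
  L = perms (suc m)
  v = suc (suc m)
  A = ascE
  q = counted k j
  q′ = counted′ k j
  fo = ⟦ firstOK j (v ∷ []) ⟧
  front : List ℕ → ℕ
  front τ = ⟦ counted k zero τ ⟧ + ⟦ counted′ k (suc zero) τ ⟧
  ∑-front : ∑[ τ ∈ L ] (fo * front τ) ≡ fo * (P (suc m) k zero + prev (λ i → P (suc m) i (suc zero)) k)
  ∑-front = trans (∑-*ˡ fo L front)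
    (cong (fo *_) (trans (∑-+ L _ _) (cong (P (suc m) k zero +_) (∑-counted′ L k (suc zero)))))

∑-ascE-counted : ∀ m k j →
  ∑[ τ ∈ perms (suc m) ] (ascE τ * ⟦ counted k j τ ⟧) + (toℕ j + k) * P (suc m) k j
    ≡ ⌊ suc m /2⌋ * P (suc m) k j
∑-ascE-counted m k j = ∑-weighted ascE (counted k j) λ {τ} τ∈ t →
  let D≡k , first = Equivalence.to T-∧ t in
  subst (λ d → ascE τ + (toℕ j + d) ≡ ⌊ suc m /2⌋) (≡ᵇ⇒≡ _ _ D≡k) (perms-ascE j τ τ∈ first)

∑-ascE-counted′ : ∀ m k j →
  ∑[ τ ∈ perms (suc m) ] (ascE τ * ⟦ counted′ k j τ ⟧) + (toℕ j + k) * prev (λ i → P (suc m) i j) k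
    ≡ suc ⌊ suc m /2⌋ * prev (λ i → P (suc m) i j) k
∑-ascE-counted′ m k j =
  subst (λ c → ∑[ τ ∈ perms (suc m) ] (ascE τ * ⟦ counted′ k j τ ⟧) + (toℕ j + k) * c
                  ≡ suc ⌊ suc m /2⌋ * c)
    (∑-counted′ (perms (suc m)) k j)
    (∑-weighted ascE (counted′ k j) λ {τ} τ∈ t →
      let 1+D≡k , first = Equivalence.to T-∧ t in
      subst (λ d → ascE τ + (toℕ j + d) ≡ suc ⌊ suc m /2⌋) (≡ᵇ⇒≡ _ _ 1+D≡k)
        (trans (cong (ascE τ +_) (+-suc (toℕ j) (desE τ)))
               (trans (+-suc (ascE τ) _) (cong suc (perms-ascE j τ τ∈ first)))))

P-recurrence : ∀ m → RecurrenceAt (suc m) ⌊ suc m /2⌋ (P (suc (suc m))) (P (suc m))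
P-recurrence m .holds k j =
  recurrence-arith (P (suc (suc m)) k j)
    (∑[ τ ∈ perms (suc m) ] (ascE τ * ⟦ counted k j τ ⟧))
    (∑[ τ ∈ perms (suc m) ] (ascE τ * ⟦ counted′ k j τ ⟧))
    (⟦ firstOK j (suc (suc m) ∷ []) ⟧ * (P (suc m) k zero + prev (λ i → P (suc m) i (suc zero)) k)) (suc m)
    (P (suc m) k j) (prev (λ i → P (suc m) i j) k) ⌊ suc m /2⌋ (toℕ j + k)
    (P-insertion m k j) (∑-ascE-counted m k j) (∑-ascE-counted′ m k j)

-- The closed form

pascal : ∀ n k → suc n C k ≡ n C k + prev (n C_) k
pascal n zero    = refl
pascal n (suc k) = trans (sym (nCk+nC[k+1]≡[n+1]C[k+1] n k)) (+-comm (n C k) (n C suc k))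

[1+k]*[1+n]C[1+k]≡[1+n]*nCk : ∀ n k → suc k * (suc n C suc k) ≡ suc n * (n C k)
[1+k]*[1+n]C[1+k]≡[1+n]*nCk zero    zero    = refl
[1+k]*[1+n]C[1+k]≡[1+n]*nCk zero    (suc k) = *-zeroʳ (suc (suc k))
[1+k]*[1+n]C[1+k]≡[1+n]*nCk (suc n) zero    =
  trans (*-identityˡ (suc (suc n) C 1)) (trans (nC1≡n (suc (suc n))) (sym (*-identityʳ (suc (suc n)))))
[1+k]*[1+n]C[1+k]≡[1+n]*nCk (suc n) (suc k) = begin
  suc (suc k) * (suc (suc n) C suc (suc k))
    ≡⟨ cong (suc (suc k) *_) (nCk+nC[k+1]≡[n+1]C[k+1] (suc n) (suc k)) ⟨
  suc (suc k) * (suc n C suc k + suc n C suc (suc k))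
    ≡⟨ split k (suc n C suc k) (suc n C suc (suc k)) ⟩
  suc k * (suc n C suc k) + suc n C suc k + suc (suc k) * (suc n C suc (suc k))
    ≡⟨ cong₂ (λ a b → a + suc n C suc k + b)
             ([1+k]*[1+n]C[1+k]≡[1+n]*nCk n k) ([1+k]*[1+n]C[1+k]≡[1+n]*nCk n (suc k)) ⟩
  suc n * (n C k) + suc n C suc k + suc n * (n C suc k)
    ≡⟨ collect n (n C k) (n C suc k) (suc n C suc k) ⟩
  suc n * (n C k + n C suc k) + suc n C suc k
    ≡⟨ cong (λ t → suc n * t + suc n C suc k) (nCk+nC[k+1]≡[n+1]C[k+1] n k) ⟩
  suc n * (suc n C suc k) + suc n C suc k
    ≡⟨ +-comm (suc n * (suc n C suc k)) (suc n C suc k) ⟩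
  suc (suc n) * (suc n C suc k) ∎
  where
  open ≡-Reasoning
  split : ∀ k y z → suc (suc k) * (y + z) ≡ suc k * y + y + suc (suc k) * z
  split = solve-∀
  collect : ∀ n a b c → suc n * a + c + suc n * b ≡ suc n * (a + b) + c
  collect = solve-∀

k*[1+n]Ck≡[1+n]*nC[k-1] : ∀ n k → k * (suc n C k) ≡ suc n * prev (n C_) k
k*[1+n]Ck≡[1+n]*nC[k-1] n zero    = sym (*-zeroʳ (suc n))
k*[1+n]Ck≡[1+n]*nC[k-1] n (suc k) = [1+k]*[1+n]C[1+k]≡[1+n]*nCk n k

-- P m k j for m = p + q + 1, with p = ⌊m/2⌋ even and q + 1 = ⌈m/2⌉ odd letters.
closedForm : ℕ → ℕ → ℕ → Fin 2 → ℕ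
closedForm p q k j = (q C k) * (p C (toℕ j + k)) * (p ! * suc q !)

prev-closedForm : ∀ p q k j →
  prev (λ i → closedForm p q i j) k ≡ prev (q C_) k * prev (p C_) (toℕ j + k) * (p ! * suc q !)
prev-closedForm p q zero    j          = refl
prev-closedForm p q (suc k) zero       = refl
prev-closedForm p q (suc k) (suc zero) = refl

-- L − R = (p − q)(u − w), phrased without subtraction.
≡-by-relation : ∀ {L R u w} p q → u ≡ w → L + (p * w + q * u) ≡ R + (p * u + q * w) → L ≡ R
≡-by-relation {L} {R} {u} p q refl eq = +-cancelʳ-≡ (p * u + q * u) L R eq

-- The recurrence instances for the closed forms, with a, b, c = C(n,k−1), C(n,k), C(n,k+1),
-- y₀, y₁ = C(n+1,k), C(n+1,k+1), e = C(n+1,k−1), z₀, z₁ = C(n+2,k), C(n+2,k+1) and f = n!.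
odd→even₀ : ∀ n k f a b y₀ fo → fo ≡ 0 → y₀ ≡ b + a → k * y₀ ≡ suc n * a →
  let F = f * (suc n * f) ; G = (suc n * f) * (suc n * f) in
  b * y₀ * G + n * (b * b * F) + k * (a * a * F)
    ≡ fo * (b * b * F + a * b * F) + suc n * (a * a * F) + (suc (n + n) + k) * (b * b * F)
odd→even₀ n k f a b .(b + a) .0 refl refl V =
  let F = f * (suc n * f) in
  ≡-by-relation (a * F) (b * F) V (solve (n ∷ k ∷ f ∷ a ∷ b ∷ []))

odd→even₁ : ∀ n k f a b c y₀ y₁ fo → fo ≡ 1 → y₀ ≡ b + a → y₁ ≡ b + c →
  k * y₀ ≡ suc n * a → suc k * y₁ ≡ suc n * b →
  let F = f * (suc n * f) ; G = (suc n * f) * (suc n * f) in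
  b * y₁ * G + n * (b * c * F) + suc k * (a * b * F)
    ≡ fo * (b * b * F + a * b * F) + suc n * (a * b * F) + (suc (n + n) + suc k) * (b * c * F)
odd→even₁ n k f a b c .(b + a) .(b + c) .1 refl refl refl V U =
  let F = f * (suc n * f) in
  ≡-by-relation (b * F) 0 V (≡-by-relation 0 (b * F) U (solve (n ∷ k ∷ f ∷ a ∷ b ∷ c ∷ [])))

even→odd₀ : ∀ n k f a b e y₀ z₀ fo → fo ≡ 1 → y₀ ≡ b + a → z₀ ≡ y₀ + e →
  k * y₀ ≡ suc n * a → k * z₀ ≡ suc (suc n) * e →
  let G = (suc n * f) * (suc n * f) ; H = (suc n * f) * (suc (suc n) * (suc n * f)) in
  y₀ * y₀ * H + suc n * (b * y₀ * G) + k * (a * e * G)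
    ≡ fo * (b * y₀ * G + a * y₀ * G) + suc (suc n) * (a * e * G) + (suc n + suc n + k) * (b * y₀ * G)
even→odd₀ n k f a b e .(b + a) .(b + a + e) .1 refl refl refl V V′ =
  let G = (suc n * f) * (suc n * f) in
  ≡-by-relation 0 ((b + a) * G) V (≡-by-relation (a * G) 0 V′ (solve (n ∷ k ∷ f ∷ a ∷ b ∷ e ∷ [])))

even→odd₁ : ∀ n k f a b c y₀ y₁ z₁ fo →
  fo ≡ 0 → y₀ ≡ b + a → y₁ ≡ b + c → z₁ ≡ y₀ + y₁ →
  k * y₀ ≡ suc n * a → suc k * y₁ ≡ suc n * b → suc k * z₁ ≡ suc (suc n) * y₀ →
  let G = (suc n * f) * (suc n * f) ; H = (suc n * f) * (suc (suc n) * (suc n * f)) in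
  y₀ * y₁ * H + suc n * (b * y₁ * G) + suc k * (a * y₀ * G)
    ≡ fo * (b * y₀ * G + a * y₀ * G) + suc (suc n) * (a * y₀ * G) + (suc n + suc n + suc k) * (b * y₁ * G)
even→odd₁ n k f a b c .(b + a) .(b + c) .(b + a + (b + c)) .0 refl refl refl refl V U U′ =
  let G = (suc n * f) * (suc n * f) in
  ≡-by-relation (a * G) 0 V (≡-by-relation ((a + (b + c)) * G) 0 U
    (≡-by-relation 0 ((b + c) * G) U′ (solve (n ∷ k ∷ f ∷ a ∷ b ∷ c ∷ []))))

isEven-n+n : ∀ n → isEven (n + n) ≡ true
isEven-n+n zero    = refl
isEven-n+n (suc n) = trans (cong (λ x → isEven (suc x)) (+-suc n n)) (isEven-n+n n)

isEven-1+n+n : ∀ n → isEven (suc (n + n)) ≡ false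
isEven-1+n+n zero    = refl
isEven-1+n+n (suc n) = trans (cong (λ x → isEven (suc (suc x))) (+-suc n n)) (isEven-1+n+n n)

isEven-n+1+n : ∀ n → isEven (n + suc n) ≡ false
isEven-n+1+n n = trans (cong isEven (+-suc n n)) (isEven-1+n+n n)

⌊1+n+n/2⌋≡n : ∀ n → ⌊ suc (n + n) /2⌋ ≡ n
⌊1+n+n/2⌋≡n zero    = refl
⌊1+n+n/2⌋≡n (suc n) = cong suc (trans (cong ⌊_/2⌋ (+-suc n n)) (⌊1+n+n/2⌋≡n n))

closedForm-recurrence-odd : ∀ n → RecurrenceAt (suc (n + n)) n (closedForm (suc n) n) (closedForm n n)
closedForm-recurrence-odd n .holds k zero rewrite prev-closedForm n n k zero | prev-closedForm n n k (suc zero) =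
  odd→even₀ n k (n !) (prev (n C_) k) (n C k) (suc n C k) _
    (cong (⟦_⟧ ∘ not) (isEven-n+n n)) (pascal n k) (k*[1+n]Ck≡[1+n]*nC[k-1] n k)
closedForm-recurrence-odd n .holds k (suc zero) rewrite prev-closedForm n n k (suc zero) =
  odd→even₁ n k (n !) (prev (n C_) k) (n C k) (n C suc k) (suc n C k) (suc n C suc k) _
    (cong ⟦_⟧ (isEven-n+n n)) (pascal n k) (sym (nCk+nC[k+1]≡[n+1]C[k+1] n k))
    (k*[1+n]Ck≡[1+n]*nC[k-1] n k) ([1+k]*[1+n]C[1+k]≡[1+n]*nCk n k)

closedForm-recurrence-even : ∀ n → RecurrenceAt (suc n + suc n) (suc n) (closedForm (suc n) (suc n)) (closedForm (suc n) n)
closedForm-recurrence-even n .holds k zero rewrite prev-closedForm (suc n) n k zero | prev-closedForm (suc n) n k (suc zero) =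
  even→odd₀ n k (n !) (prev (n C_) k) (n C k) (prev (suc n C_) k) (suc n C k) (suc (suc n) C k) _
    (cong (⟦_⟧ ∘ not) (isEven-n+1+n n)) (pascal n k) (pascal (suc n) k)
    (k*[1+n]Ck≡[1+n]*nC[k-1] n k) (k*[1+n]Ck≡[1+n]*nC[k-1] (suc n) k)
closedForm-recurrence-even n .holds k (suc zero) rewrite prev-closedForm (suc n) n k (suc zero) =
  even→odd₁ n k (n !) (prev (n C_) k) (n C k) (n C suc k) (suc n C k) (suc n C suc k) (suc (suc n) C suc k) _
    (cong ⟦_⟧ (isEven-n+1+n n)) (pascal n k) (sym (nCk+nC[k+1]≡[n+1]C[k+1] n k))
    (sym (nCk+nC[k+1]≡[n+1]C[k+1] (suc n) k))
    (k*[1+n]Ck≡[1+n]*nC[k-1] n k) ([1+k]*[1+n]C[1+k]≡[1+n]*nCk n k) ([1+k]*[1+n]C[1+k]≡[1+n]*nCk (suc n) k)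

prev-cong : ∀ {f g : ℕ → ℕ} → (∀ i → f i ≡ g i) → ∀ k → prev f k ≡ prev g k
prev-cong f≗g zero    = refl
prev-cong f≗g (suc k) = f≗g k

RecurrenceAt-resp : ∀ {m h h′ next cur cur′} → h ≡ h′ → (∀ k j → cur k j ≡ cur′ k j) →
                    RecurrenceAt m h next cur → RecurrenceAt m h′ next cur′
RecurrenceAt-resp refl cur≗ rec .holds k j
  rewrite sym (cur≗ k j) | sym (cur≗ k zero)
        | sym (prev-cong (λ i → cur≗ i j) k) | sym (prev-cong (λ i → cur≗ i (suc zero)) k) = rec .holds k j

recurrence-unique : ∀ {m h next next′ cur} → RecurrenceAt m h next cur → RecurrenceAt m h next′ cur →
                    ∀ k j → next k j ≡ next′ k j
recurrence-unique {h = h} {next} {next′} {cur} rec rec′ k j =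
  +-cancelʳ-≡ (h * cur k j) (next k j) (next′ k j)
    (+-cancelʳ-≡ ((toℕ j + k) * prev (λ i → cur i j) k) _ _ (trans (rec .holds k j) (sym (rec′ .holds k j))))

mutual
  P-odd : ∀ n k j → P (suc (n + n)) k j ≡ closedForm n n k j
  P-odd zero    zero    zero       = refl
  P-odd zero    zero    (suc zero) = refl
  P-odd zero    (suc k) j          = refl
  P-odd (suc n) = recurrence-unique
    (RecurrenceAt-resp (sym (n≡⌊n+n/2⌋ (suc n))) (P-even n) (P-recurrence (n + suc n)))
    (closedForm-recurrence-even n)

  P-even : ∀ n k j → P (suc n + suc n) k j ≡ closedForm (suc n) n k j
  P-even n k j = trans (cong (λ m → P (suc m) k j) (+-suc n n)) (recurrence-unique
    (RecurrenceAt-resp (⌊1+n+n/2⌋≡n n) (P-odd n) (P-recurrence (n + n)))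
    (closedForm-recurrence-odd n) k j)

-- The identity holds for every k.
theorem4p6 : ∀ n k → 1 ≤ n → k ≤ n →
    HasCard (PSet (suc zero) k (2 * n)) (((n ∸ 1) C k) * (n C suc k) * ((n !) * (n !)))
    × HasCard (PSet zero k (2 * n)) (((n ∸ 1) C k) * (n C k) * ((n !) * (n !)))
theorem4p6 (suc n) k _ _ = card (suc zero) , card zero
  where
  card : ∀ j → HasCard (PSet j k (2 * suc n)) (closedForm (suc n) n k j)
  card j = subst (HasCard (PSet j k (2 * suc n)))
    (trans (cong (λ m → P m k j) (cong (suc n +_) (+-identityʳ (suc n)))) (P-even n k j))
    (PSet↔P j k (2 * suc n))
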